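{- Let $n$ be a positive integer. Suppose $c\geq2$ is an integer with prime factorization $p_1^{a_1}p_2^{a_2}\dotsm p_k^{a_k}$, where $p_1<p_2<\dotsb<p_k$ are primes and $a_i\geq1$ for all $i$. If $p_1>(n+1)^2/4$, then there is no arithmetical structure on $K_n$ with $r_1=c$.
   Context: An arithmetical structure on the complete graph $K_n$ (with $n$ vertices) is a collection of positive integers $r_1,r_2,\dotsc,r_n$ with $\gcd(r_1,\dotsc,r_n)=1$ such that $r_j$ divides $\sum_{i=1}^n r_i$ for every $j$. The values are ordered so that $r_1\geq r_2\geq\dotsb\geq r_n$; thus $r_1$ is the largest value of the structure. -}

module Defs where

open import Data.Nat using (ℕ; zero; suc; _+_; _≤_; _<_)
open import Data.Nat.Divisibility using (_∣_)
open import Data.Nat.GCD using (gcd)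
open import Data.Fin using (Fin)
open import Data.Vec.Functional using (Vector; foldr)
open import Data.Product using (_×_; ∃)
open import Relation.Binary.PropositionalEquality using (_≡_)

sumV : ∀ {n} → Vector ℕ n → ℕ
sumV = foldr _+_ 0

gcdV : ∀ {n} → Vector ℕ n → ℕ
gcdV = foldr gcd 0

record IsArithStructK (n : ℕ) (r : Vector ℕ n) : Set where
  field
    positive  : ∀ i → 0 < r i
    coprime   : gcdV r ≡ 1
    divSum    : ∀ j → r j ∣ sumV r

-- The largest value r_1 of the structure (values sorted decreasingly) equals c.
LargestValue : ∀ {n} → Vector ℕ n → ℕ → Set
LargestValue {n} r c = (∃ λ (i : Fin n) → r i ≡ c) × (∀ i → r i ≤ c)

{-# OPTIONS --safe #-}
module Submission where

-- Let p be the least prime factor of c and S = m c the sum of a structure with largest value c.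
-- For a value r < c write S = d r; if d < p then d is coprime to c, so c ∣ r, impossible.
-- Hence p r ≤ S.  If t values equal c and u ≥ 1 do not, then p S ≤ t p c + u S, and since
-- t < m this forces p ≤ u (t + 1) ≤ (n + 1)² / 4.  If u = 0 every value is c ≥ 2, against gcd 1.

open import Defs
open import Data.Nat using (ℕ; suc; _*_; _≤_; _<_)
open import Data.Nat.Divisibility using (_∣_)
open import Data.Nat.Primality using (Prime)
open import Data.Vec.Functional using (Vector)
open import Relation.Nullary using (¬_)
open import Data.Product using (_×_)

open import Data.Nat using (zero; _+_; z≤n; s≤s; NonZero; NonTrivial; >-nonZero; _≤?_)
open import Data.Nat.Properties
open import Data.Nat.Divisibility using (_∣?_; divides; ∣-refl; ∣⇒≤; _∣0; 0∣⇒≡0)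
open import Data.Nat.Divisibility.Core using (hasNonTrivialDivisor)
open import Data.Nat.Primality using (_Rough_; prime⇒nonTrivial; rough∧∣⇒prime; ∤⇒rough-suc; 2-rough)
open import Data.Nat.Coprimality using (Coprime; coprime-divisor)
open import Data.Nat.GCD using (gcd-greatest)
open import Data.Fin using (zero; suc)
open import Data.Product using (∃; _,_)
open import Data.Sum using (_⊎_; inj₁; inj₂)
open import Data.Empty using (⊥-elim)
open import Relation.Nullary using (yes; no; contradiction)
open import Relation.Binary.PropositionalEquality
open import Data.Nat.Tactic.RingSolver using (solve-∀)

open IsArithStructK using (positive; coprime; divSum)

private
  variable
    a b c d m n p x S : ℕ

rough∧∣⇒≤ : .{{NonTrivial d}} → m Rough n → d ∣ n → m ≤ d
rough∧∣⇒≤ rough d∣n = ≮⇒≥ λ d<m → rough (hasNonTrivialDivisor d<m d∣n)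

rough∧<⇒coprime : m Rough n → 0 < d → d < m → Coprime n d
rough∧<⇒coprime {d = d} rough d>0 d<m {zero} (_ , 0∣d) = contradiction (0∣⇒≡0 0∣d) (n>0⇒n≢0 d>0)
rough∧<⇒coprime rough d>0 d<m {1} _ = refl
rough∧<⇒coprime rough d>0 d<m {suc (suc e)} (e∣n , e∣d) =
  ⊥-elim (rough (hasNonTrivialDivisor (≤-<-trans (∣⇒≤ {{>-nonZero d>0}} e∣d) d<m) e∣n))

-- Trial division by 2 + j, 3 + j, … ; the fuel k runs out exactly at the candidate n itself.
roughPrimeDivisorFrom : ∀ j k → (2 + j) Rough n → k + (2 + j) ≡ n →
                        ∃ λ p → Prime p × p ∣ n × p Rough n
roughPrimeDivisorFrom j zero    rough refl = 2 + j , rough∧∣⇒prime rough ∣-refl , ∣-refl , rough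
roughPrimeDivisorFrom {n} j (suc k) rough k+j≡n with (2 + j) ∣? n
... | yes j∣n = 2 + j , rough∧∣⇒prime rough j∣n , j∣n , rough
... | no  j∤n = roughPrimeDivisorFrom (suc j) k (∤⇒rough-suc j∤n rough) (trans (+-suc k (2 + j)) k+j≡n)

roughPrimeDivisor : 2 ≤ n → ∃ λ p → Prime p × p ∣ n × p Rough n
roughPrimeDivisor n≥2 = roughPrimeDivisorFrom 0 _ 2-rough (m∸n+n≡m n≥2)

divisor∧multiple⇒≡⊎*≤ : p Rough c → 0 < S → x ∣ S → c ∣ S → 0 < x → x ≤ c → x ≡ c ⊎ p * x ≤ S
divisor∧multiple⇒≡⊎*≤ {p} {x = x} rough S>0 (divides d refl) c∣S x>0 x≤c with p ≤? d
... | yes p≤d = inj₂ (*-monoˡ-≤ x p≤d)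
... | no  p≰d = inj₁ (≤-antisym x≤c (∣⇒≤ {{>-nonZero x>0}} (coprime-divisor d⊥c c∣S)))
  where
  d>0 : 0 < d
  d>0 = n≢0⇒n>0 (λ { refl → <-irrefl refl S>0 })
  d⊥c : Coprime _ d
  d⊥c = rough∧<⇒coprime rough d>0 (≰⇒> p≰d)

≤-sumV : ∀ {n} (r : Vector ℕ n) i → r i ≤ sumV r
≤-sumV r zero    = m≤m+n (r zero) _
≤-sumV r (suc i) = ≤-trans (≤-sumV (λ j → r (suc j)) i) (m≤n+m _ (r zero))

∣-gcdV : ∀ {n} (r : Vector ℕ n) → (∀ i → d ∣ r i) → d ∣ gcdV r
∣-gcdV {n = zero}  r d∣r = _ ∣0
∣-gcdV {n = suc n} r d∣r = gcd-greatest (d∣r zero) (∣-gcdV (λ i → r (suc i)) (λ i → d∣r (suc i)))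

-- t entries equal c and the other u entries x satisfy p x ≤ K.
record Tally {n} (r : Vector ℕ n) (p c K : ℕ) : Set where
  field
    t u     : ℕ
    t+u≡n   : t + u ≡ n
    p*sum≤  : p * sumV r ≤ t * (p * c) + u * K
    sum≥    : t * c + u ≤ sumV r
    u≡0⇒≡c  : u ≡ 0 → ∀ i → r i ≡ c

tally : ∀ {c K n} p (r : Vector ℕ n) → (∀ i → r i ≡ c ⊎ p * r i ≤ K) → (∀ i → 0 < r i) → Tally r p c K
tally {n = zero} p r split pos = record
  { t = 0 ; u = 0 ; t+u≡n = refl ; p*sum≤ = ≤-reflexive (*-zeroʳ p) ; sum≥ = z≤n ; u≡0⇒≡c = λ _ () }
tally {c} {K} {suc n} p r split pos with tally p (λ i → r (suc i)) (λ i → split (suc i)) (λ i → pos (suc i)) | split zero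
... | record { t = t ; u = u ; t+u≡n = t+u≡n ; p*sum≤ = ub ; sum≥ = lb ; u≡0⇒≡c = all≡c } | inj₁ refl = record
  { t = suc t ; u = u ; t+u≡n = cong suc t+u≡n
  ; p*sum≤ = ≤-trans (≤-reflexive (*-distribˡ-+ p c _))
                     (≤-trans (+-monoʳ-≤ (p * c) ub) (≤-reflexive (sym (+-assoc (p * c) _ _))))
  ; sum≥   = ≤-trans (≤-reflexive (+-assoc c _ u)) (+-monoʳ-≤ c lb)
  ; u≡0⇒≡c = λ { u≡0 zero → refl ; u≡0 (suc i) → all≡c u≡0 i } }
... | record { t = t ; u = u ; t+u≡n = t+u≡n ; p*sum≤ = ub ; sum≥ = lb } | inj₂ p*r≤K = record
  { t = t ; u = suc u ; t+u≡n = trans (+-suc t u) (cong suc t+u≡n)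
  ; p*sum≤ = ≤-trans (≤-reflexive (*-distribˡ-+ p (r zero) _))
                     (≤-trans (+-mono-≤ p*r≤K ub) (≤-reflexive (shuffle K (t * (p * c)) (u * K))))
  ; sum≥   = ≤-trans (≤-reflexive (+-suc (t * c) u)) (+-mono-≤ (pos zero) lb)
  ; u≡0⇒≡c = λ () }
  where
  shuffle : ∀ a b e → a + (b + e) ≡ b + (a + e)
  shuffle = solve-∀

4*≤square-≤ : a ≤ b → 4 * (a * b) ≤ (a + b) * (a + b)
4*≤square-≤ {a} a≤b with m≤n⇒∃[o]m+o≡n a≤b
... | e , refl = ≤-trans (m≤m+n _ (e * e)) (≤-reflexive (square a e))
  where
  square : ∀ a e → 4 * (a * (a + e)) + e * e ≡ (a + (a + e)) * (a + (a + e))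
  square = solve-∀

4*≤square : ∀ a b → 4 * (a * b) ≤ (a + b) * (a + b)
4*≤square a b with ≤-total a b
... | inj₁ a≤b = 4*≤square-≤ a≤b
... | inj₂ b≤a = subst₂ _≤_ (cong (4 *_) (*-comm b a)) (cong (λ s → s * s) (+-comm b a)) (4*≤square-≤ b≤a)

-- With S = m c the bounds give t < m; writing m = t + s with s ≥ 1, cancelling c and p t
-- leaves p s ≤ u m, and m ≤ (t + 1) s.
tally⇒≤ : ∀ {t u} → .{{NonZero c}} → S ≡ m * c → p * S ≤ t * (p * c) + u * S → t * c + u ≤ S → 1 ≤ u →
          p ≤ u * suc t
tally⇒≤ {c} {S} {m} {p} {t} {u} refl ub lb u≥1 with m≤n⇒∃[o]m+o≡n t<m
  where
  t<m : t < m
  t<m = *-cancelʳ-< c t m (<-≤-trans (≤-trans (≤-reflexive (sym (+-identityʳ _))) (+-monoʳ-< (t * c) u≥1)) lb)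
... | o , refl = *-cancelʳ-≤ p (u * suc t) (suc o) (≤-trans p*s≤u*m (≤-reflexive (u*m≡ u t o)))
  where
  p*m≤ : p * (suc t + o) ≤ t * p + u * (suc t + o)
  p*m≤ = *-cancelʳ-≤ _ _ c (subst₂ _≤_ (lhs p t o c) (rhs t p c u o) ub)
    where
    lhs : ∀ p t o c → p * ((suc t + o) * c) ≡ p * (suc t + o) * c
    lhs = solve-∀
    rhs : ∀ t p c u o → t * (p * c) + u * ((suc t + o) * c) ≡ (t * p + u * (suc t + o)) * c
    rhs = solve-∀
  p*s≤u*m : p * suc o ≤ u * (suc t + o) + u * (t * o)
  p*s≤u*m = +-cancelˡ-≤ (t * p) _ _
    (subst₂ _≤_ (split p t o) (+-assoc (t * p) _ _) (≤-trans p*m≤ (m≤m+n _ (u * (t * o)))))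
    where
    split : ∀ p t o → p * (suc t + o) ≡ t * p + p * suc o
    split = solve-∀
  u*m≡ : ∀ u t o → u * (suc t + o) + u * (t * o) ≡ u * suc t * suc o
  u*m≡ = solve-∀

rough∧largest⇒4*≤square : ∀ {n} {r : Vector ℕ n} → 2 ≤ c → p Rough c → IsArithStructK n r → LargestValue r c →
                    4 * p ≤ suc n * suc n
rough∧largest⇒4*≤square {c} {p} {r = r} c≥2 rough struct ((i , rᵢ≡c) , r≤c)
  with subst (_∣ sumV r) rᵢ≡c (divSum struct i)
... | c∣S@(divides m S≡m*c) with tally p r dichotomy (positive struct)
  where
  S>0 : 0 < sumV r
  S>0 = ≤-trans (<⇒≤ c≥2) (subst (_≤ sumV r) rᵢ≡c (≤-sumV r i))
  dichotomy : ∀ j → r j ≡ c ⊎ p * r j ≤ sumV r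
  dichotomy j = divisor∧multiple⇒≡⊎*≤ rough S>0 (divSum struct j) c∣S (positive struct j) (r≤c j)
... | record { u = zero ; u≡0⇒≡c = all≡c } = contradiction c≤1 (<⇒≱ c≥2)
  where
  c≤1 : c ≤ 1
  c≤1 = ∣⇒≤ (subst (c ∣_) (coprime struct) (∣-gcdV r λ j → subst (c ∣_) (sym (all≡c refl j)) ∣-refl))
... | record { t = t ; u = suc u ; t+u≡n = refl ; p*sum≤ = ub ; sum≥ = lb } =
  ≤-trans (*-monoʳ-≤ 4 (tally⇒≤ {m = m} {p} {{>-nonZero (<⇒≤ c≥2)}} S≡m*c ub lb (s≤s z≤n)))
          (≤-trans (4*≤square (suc u) (suc t)) (≤-reflexive (square t u)))
  where
  square : ∀ t u → (suc u + suc t) * (suc u + suc t) ≡ suc (t + suc u) * suc (t + suc u)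
  square = solve-∀

theorem3p1 : (n : ℕ) → 1 ≤ n → (c : ℕ) → 2 ≤ c →
    ((p : ℕ) → Prime p → p ∣ c →
      (∀ q → Prime q → q ∣ c → p ≤ q) → suc n * suc n < 4 * p) →
    (r : Vector ℕ n) → IsArithStructK n r → ¬ LargestValue r c
theorem3p1 n _ c c≥2 bound r struct largest with roughPrimeDivisor c≥2
... | p , prime-p , p∣c , rough =
  <-irrefl refl (<-≤-trans (bound p prime-p p∣c least) (rough∧largest⇒4*≤square c≥2 rough struct largest))
  where
  least : ∀ q → Prime q → q ∣ c → p ≤ q
  least q prime-q q∣c = rough∧∣⇒≤ {{prime⇒nonTrivial prime-q}} rough q∣c
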